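{- Let $G$ be a graph, $U\subseteq V(G)$ and $\ell\in\mathbb{N}$. If the algorithm ApproxPHCAD returns a set $A$ of size larger than $6\ell$ when called on $G'=\mathsf{copy}(G,U,6\ell)$, then $\{U\}$ is $\ell$-necessary, i.e., every $\ell$-solution of $G$ intersects $U$.
   Context: A proper Helly circular-arc graph is the intersection graph of a finite family of arcs on a circle such that no arc properly contains another and every subfamily of pairwise intersecting arcs has a common point. ApproxPHCAD is a polynomial-time 6-approximation algorithm for PHCAVD: given a graph $H$ it returns $S\subseteq V(H)$ such that $H-S$ is a proper Helly circular-arc graph and $|S|\le 6\cdot\mathrm{opt}(H)$, where $\mathrm{opt}(H)$ is the minimum size of such a set. An $\ell$-solution of $G$ is a set $S\subseteq V(G)$ with $|S|\le\ell$ such that $G-S$ is a proper Helly circular-arc graph. A family $\mathcal W\subseteq 2^{V(G)}$ is $\ell$-necessary if every $\ell$-solution intersects every member of $\mathcal W$. $\mathsf{copy}(G,U,t)$ is the graph obtained from $G$ by adding, for each $u\in U$, $t$ new vertices $u^1,\dots,u^t$ such that $u,u^1,\dots,u^t$ form a clique, each $u^i$ is adjacent to every neighbor $v$ of $u$ in $G$, and $u^iv^j$ is an edge whenever $uv\in E(G)$ with $u,v\in U$. -}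

module Defs where

open import Data.Nat using (ℕ; zero; suc; _+_; _*_; _≤_; _<_)
open import Data.Nat.DivMod using (_%_)
open import Data.Fin using (Fin; toℕ)
open import Data.Fin.Subset using (Subset) renaming (_∈_ to _∈ₛ_)
open import Data.List using (List; length)
open import Data.List.Membership.Propositional using (_∈_; _∉_)
open import Data.List.Relation.Unary.Unique.Propositional using (Unique)
open import Data.Product using (Σ; ∃; ∃-syntax; _×_; _,_)
open import Data.Sum using (_⊎_; inj₁; inj₂)
open import Data.Empty using (⊥)
open import Relation.Nullary using (¬_)
open import Relation.Binary.PropositionalEquality using (_≡_; _≢_; refl; sym)
open import Function.Bundles using (_⇔_)

record Graph (V : Set) : Set₁ where
  field
    Adj     : V → V → Set
    symAdj  : ∀ {u v} → Adj u v → Adj v u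
    irrefl  : ∀ {v} → ¬ Adj v v
open Graph public

-- Arcs on a (discretised) circle with suc k points 0 … k, in cyclic order.
-- The arc (start , len) is the closed arc {start, start+1, …, start+len}
-- (mod suc k); len ≤ k, so len = k gives the whole circle.

record Arc (k : ℕ) : Set where
  constructor arc
  field
    start : Fin (suc k)
    len   : ℕ
    len≤k : len ≤ k
open Arc public

_on_ : ∀ {k} → Fin (suc k) → Arc k → Set
_on_ {k} p a = ∃[ d ] (d ≤ len a × toℕ p ≡ (toℕ (start a) + d) % suc k)

Intersect : ∀ {k} → Arc k → Arc k → Set
Intersect a b = ∃[ p ] (p on a × p on b)

ProperlyContains : ∀ {k} → Arc k → Arc k → Set
ProperlyContains a b = (∀ p → p on b → p on a) × (∃[ p ] (p on a × ¬ (p on b)))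

-- "G - S is a proper Helly circular-arc graph", where S ⊆ V(G) is given
-- as a list of vertices: a proper Helly circular-arc model of the
-- subgraph of G induced by the vertices not in S.

record PHCAModel {V : Set} (G : Graph V) (S : List V) : Set where
  field
    k       : ℕ
    arcOf   : V → Arc k
    model   : ∀ u v → u ∉ S → v ∉ S → u ≢ v →
              (Adj G u v ⇔ Intersect (arcOf u) (arcOf v))
    proper  : ∀ u v → u ∉ S → v ∉ S →
              ¬ ProperlyContains (arcOf u) (arcOf v)
    helly   : ∀ (T : List V) → (∀ u → u ∈ T → u ∉ S) →
              (∀ u v → u ∈ T → v ∈ T → Intersect (arcOf u) (arcOf v)) →
              ∃[ p ] (∀ u → u ∈ T → p on arcOf u)

PHCAMinus : ∀ {V : Set} → Graph V → List V → Set
PHCAMinus G S = PHCAModel G S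

Solution : ∀ {V : Set} → Graph V → List V → Set
Solution H S = Unique S × PHCAMinus H S

LSolution : ∀ {V : Set} → Graph V → ℕ → List V → Set
LSolution G ℓ S = Solution G S × length S ≤ ℓ

-- A is a possible output of ApproxPHCAD on H: a solution of H with
-- |A| ≤ 6 · opt(H), i.e. |A| ≤ 6 |S| for every solution S of H.
ApproxPHCADOutput : ∀ {V : Set} → Graph V → List V → Set
ApproxPHCADOutput H A =
  Solution H A × (∀ S → Solution H S → length A ≤ 6 * length S)

-- copy(G, U, t).  Vertices: original vertices inj₁ v, and the copies
-- u^1 … u^t of each u ∈ U, written inj₂ (u , u∈U , i) with i : Fin t.

CopyV : (n : ℕ) → Subset n → ℕ → Set
CopyV n U t = Fin n ⊎ Σ (Fin n) (λ u → (u ∈ₛ U) × Fin t)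

module _ {n : ℕ} (G : Graph (Fin n)) (U : Subset n) (t : ℕ) where

  CopyAdj : CopyV n U t → CopyV n U t → Set
  CopyAdj (inj₁ u) (inj₁ v) = Adj G u v
  CopyAdj (inj₁ v) (inj₂ (u , _ , j)) = (v ≡ u) ⊎ Adj G u v
  CopyAdj (inj₂ (u , _ , i)) (inj₁ v) = (u ≡ v) ⊎ Adj G u v
  CopyAdj (inj₂ (u , _ , i)) (inj₂ (v , _ , j)) = ((u ≡ v) × (i ≢ j)) ⊎ Adj G u v

  private
    copySym : ∀ {x y} → CopyAdj x y → CopyAdj y x
    copySym {inj₁ u} {inj₁ v} e = symAdj G e
    copySym {inj₁ v} {inj₂ _} (inj₁ eq) = inj₁ (sym eq)
    copySym {inj₁ v} {inj₂ _} (inj₂ e) = inj₂ e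
    copySym {inj₂ _} {inj₁ v} (inj₁ eq) = inj₁ (sym eq)
    copySym {inj₂ _} {inj₁ v} (inj₂ e) = inj₂ e
    copySym {inj₂ _} {inj₂ _} (inj₁ (eq , ne)) = inj₁ (sym eq , λ e → ne (sym e))
    copySym {inj₂ _} {inj₂ _} (inj₂ e) = inj₂ (symAdj G e)

    copyIrr : ∀ {x} → ¬ CopyAdj x x
    copyIrr {inj₁ u} e = irrefl G e
    copyIrr {inj₂ _} (inj₁ (_ , ne)) = ne refl
    copyIrr {inj₂ _} (inj₂ e) = irrefl G e

  copy : Graph (CopyV n U t)
  copy = record { Adj = CopyAdj ; symAdj = λ {x} {y} → copySym {x} {y} ; irrefl = λ {x} → copyIrr {x} }

module Submission where

-- If some ℓ-solution S of G avoided U, every copy u^i could be given the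
-- arc of its original u: copies of one vertex then get equal (hence
-- intersecting, mutually non-containing) arcs, and the Helly property of
-- the copies reduces to that of their originals. So S would remain a
-- solution of copy(G, U, 6ℓ), giving opt ≤ ℓ and |A| ≤ 6 opt ≤ 6ℓ.

open import Defs
open import Data.Nat using (ℕ; suc; _+_; _*_; _≤_; _<_; z≤n)
open import Data.Nat.Properties using (*-monoʳ-≤; <⇒≱; +-identityʳ; module ≤-Reasoning)
open import Data.Nat.DivMod using (_%_; m<n⇒m%n≡m)
open import Data.Fin using (Fin; toℕ; _≟_)
open import Data.Fin.Properties using (toℕ<n)
open import Data.Fin.Subset using (Subset) renaming (_∈_ to _∈ₛ_)
open import Data.Fin.Subset.Properties using () renaming (_∈?_ to _∈ₛ?_)
open import Data.Vec.Properties.WithK using ([]=-irrelevant)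
open import Data.List using (List; length; map)
open import Data.List.Properties using (length-map)
open import Data.List.Membership.Propositional using (_∈_; _∉_; find; lose)
open import Data.List.Membership.Propositional.Properties using (∈-map⁺; ∈-map⁻)
open import Data.List.Relation.Unary.Any using (any?)
open import Data.List.Relation.Unary.Unique.Propositional.Properties using () renaming (map⁺ to Unique-map⁺)
open import Data.Product using (∃-syntax; _×_; _,_; proj₁)
open import Data.Sum using (_⊎_; inj₁; inj₂; [_,_]′; map₁; map₂)
open import Function using (id; _∘_)
open import Function.Bundles using (_⇔_; mk⇔; Equivalence)
open import Relation.Nullary using (¬_; yes; no; contradiction)
open import Relation.Binary.PropositionalEquality using (_≡_; _≢_; refl; sym; cong; subst)

Intersect-refl : ∀ {k} (a : Arc k) → Intersect a a
Intersect-refl {k} a = start a , (0 , z≤n , start-on) , (0 , z≤n , start-on)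
  where
  start-on : toℕ (start a) ≡ (toℕ (start a) + 0) % suc k
  start-on rewrite +-identityʳ (toℕ (start a)) = sym (m<n⇒m%n≡m (toℕ<n (start a)))

∈-map-elim : ∀ {A B : Set} {P : B → Set} (f : A → B) {xs : List A} →
             (∀ x → x ∈ xs → P (f x)) → ∀ y → y ∈ map f xs → P y
∈-map-elim f h y y∈ with ∈-map⁻ f y∈
... | x , x∈ , refl = h x x∈

module _ {n : ℕ} (G : Graph (Fin n)) (U : Subset n) (t : ℕ) where

  origin : CopyV n U t → Fin n
  origin (inj₁ v)           = v
  origin (inj₂ (u , _ , _)) = u

  copy-Adj⇔ : ∀ {x y} → x ≢ y →
              Adj (copy G U t) x y ⇔ (origin x ≡ origin y ⊎ Adj G (origin x) (origin y))
  copy-Adj⇔ {inj₁ u} {inj₁ v} x≢y =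
    mk⇔ inj₂ [ (λ u≡v → contradiction (cong inj₁ u≡v) x≢y) , id ]′
  copy-Adj⇔ {inj₁ _} {inj₂ _} _ = mk⇔ (map₂ (symAdj G)) (map₂ (symAdj G))
  copy-Adj⇔ {inj₂ _} {inj₁ _} _ = mk⇔ id id
  copy-Adj⇔ {inj₂ (u , u∈U , i)} {inj₂ (v , v∈U , j)} x≢y =
    mk⇔ (map₁ proj₁) [ distinct-copies , inj₂ ]′
    where
    distinct-copies : u ≡ v → (u ≡ v × i ≢ j) ⊎ Adj G u v
    distinct-copies refl = inj₁ (refl , λ { refl →
      x≢y (cong (λ u∈U → inj₂ (u , u∈U , i)) ([]=-irrelevant u∈U v∈U)) })

  module _ {S : List (Fin n)} (S∩U=∅ : ∀ {u} → u ∈ S → ¬ u ∈ₛ U) (M : PHCAModel G S) where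
    open PHCAModel M

    origin-∉ : ∀ {x} → x ∉ map inj₁ S → origin x ∉ S
    origin-∉ {inj₁ _}           x∉ u∈S = x∉ (∈-map⁺ inj₁ u∈S)
    origin-∉ {inj₂ (_ , u∈U , _)} _  u∈S = S∩U=∅ u∈S u∈U

    copy-model : ∀ x y → x ∉ map inj₁ S → y ∉ map inj₁ S → x ≢ y →
                 Adj (copy G U t) x y ⇔ Intersect (arcOf (origin x)) (arcOf (origin y))
    copy-model x y x∉ y∉ x≢y with origin x ≟ origin y
    ... | yes same =
      mk⇔ (λ _ → subst (Intersect (arcOf (origin x)) ∘ arcOf) same (Intersect-refl (arcOf (origin x))))
          (λ _ → Equivalence.from (copy-Adj⇔ x≢y) (inj₁ same))
    ... | no differ =
      mk⇔ (Equivalence.to original ∘ [ (λ same → contradiction same differ) , id ]′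
                                    ∘ Equivalence.to (copy-Adj⇔ x≢y))
          (Equivalence.from (copy-Adj⇔ x≢y) ∘ inj₂ ∘ Equivalence.from original)
      where original = model (origin x) (origin y) (origin-∉ x∉) (origin-∉ y∉) differ

    copy-helly : ∀ (T : List (CopyV n U t)) → (∀ x → x ∈ T → x ∉ map inj₁ S) →
                 (∀ x y → x ∈ T → y ∈ T → Intersect (arcOf (origin x)) (arcOf (origin y))) →
                 ∃[ p ] (∀ x → x ∈ T → p on arcOf (origin x))
    copy-helly T T∩S=∅ pairwise
      with helly (map origin T)
                 (∈-map-elim origin (λ x x∈T → origin-∉ (T∩S=∅ x x∈T)))
                 (λ u v u∈ v∈ → ∈-map-elim origin
                    (λ x x∈T → ∈-map-elim origin (λ y y∈T → pairwise x y x∈T y∈T) v v∈) u u∈)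
    ... | p , p-common = p , λ x x∈T → p-common (origin x) (∈-map⁺ origin x∈T)

    copy-PHCAModel : PHCAModel (copy G U t) (map inj₁ S)
    copy-PHCAModel = record
      { k      = k
      ; arcOf  = arcOf ∘ origin
      ; model  = copy-model
      ; proper = λ x y x∉ y∉ → proper (origin x) (origin y) (origin-∉ x∉) (origin-∉ y∉)
      ; helly  = copy-helly
      }

  copy-Solution : ∀ {S} → (∀ {u} → u ∈ S → ¬ u ∈ₛ U) →
                  Solution G S → Solution (copy G U t) (map inj₁ S)
  copy-Solution S∩U=∅ (S-unique , M) =
    Unique-map⁺ (λ { refl → refl }) S-unique , copy-PHCAModel S∩U=∅ M

lemma4 : ∀ {n} (G : Graph (Fin n)) (U : Subset n) (ℓ : ℕ)
    (A : List (CopyV n U (6 * ℓ))) →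
    ApproxPHCADOutput (copy G U (6 * ℓ)) A →
    6 * ℓ < length A →
    ∀ (S : List (Fin n)) → LSolution G ℓ S →
    ∃[ u ] (u ∈ S × u ∈ₛ U)
lemma4 G U ℓ A (_ , A-approx) 6ℓ<|A| S (S-solution , |S|≤ℓ) with any? (_∈ₛ? U) S
... | yes S∩U = find S∩U
... | no S∩U=∅ = contradiction |A|≤6ℓ (<⇒≱ 6ℓ<|A|)
  where
  open ≤-Reasoning
  |A|≤6ℓ : length A ≤ 6 * ℓ
  |A|≤6ℓ = begin
    length A                 ≤⟨ A-approx _ (copy-Solution G U (6 * ℓ)
                                  (λ u∈S u∈U → S∩U=∅ (lose u∈S u∈U)) S-solution) ⟩
    6 * length (map inj₁ S)  ≡⟨ cong (6 *_) (length-map inj₁ S) ⟩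
    6 * length S             ≤⟨ *-monoʳ-≤ 6 |S|≤ℓ ⟩
    6 * ℓ                    ∎
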